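{- Let $k$ be a positive integer and let $\sigma\in\mathrm{SIM}(X)$ be an element whose disjoint path and cycle decomposition consists only of paths. Suppose $\sigma=\alpha_1\cdots\alpha_n$, where the $\alpha_i$ are products of pairwise disjoint groups of the paths of $\sigma$ (every path of $\sigma$ lying in exactly one $\alpha_i$), each $\alpha_i$ is composed of paths of weakly varying lengths, and whenever $\sigma_s$ is a path of $\alpha_i$ and $\sigma_t$ is a path of $\alpha_j$ with $i\neq j$, we have $|\ell(\sigma_s)-\ell(\sigma_t)|>1$. Let $B_i$ be the set of digits of the paths of $\alpha_i$, and regard $\alpha_i\in\mathrm{SIM}(B_i)$. Then \[ r_k(\sigma)=r_k(\alpha_1)\cdots r_k(\alpha_n), \] where $r_k(\sigma)$ is computed in $\mathrm{SIM}(X)$ and $r_k(\alpha_i)$ in $\mathrm{SIM}(B_i)$.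
   Context: For a finite set $X$, $\mathrm{SIM}(X)$ is the symmetric inverse monoid: the set of all partial one-to-one maps from $X$ to itself, under composition. For distinct $a_1,\dots,a_\ell$, the path $[a_1a_2\cdots a_\ell]$ is the partial map sending $a_i\mapsto a_{i+1}$ for $i<\ell$ and undefined at $a_\ell$ (so $[a]$ is the nowhere-defined map on $\{a\}$); the cycle $(a_1\cdots a_\ell)$ sends $a_i\mapsto a_{i+1}$ for $i<\ell$ and $a_\ell\mapsto a_1$. Its length is $\ell$ and $a_1,\dots,a_\ell$ are its digits. Paths/cycles are disjoint if their digit sets are disjoint, and a product of disjoint paths/cycles is the partial map on the union of their digits agreeing with each one on its digits. Every element of $\mathrm{SIM}(X)$ is uniquely a product of disjoint paths and cycles whose digit sets partition $X$ (its disjoint path and cycle decomposition, length-one paths and cycles included). For a positive integer $k$, a $k$th root of $\sigma\in\mathrm{SIM}(X)$ is an $\alpha\in\mathrm{SIM}(X)$ with $\alpha^k=\sigma$, and $r_k(\sigma)$ denotes the number of $k$th roots of $\sigma$. Paths $\tau_1,\dots,\tau_r$ are of weakly varying length if they can be reordered as $\beta_1,\dots,\beta_r$ with $\ell(\beta_1)\leq\cdots\leq\ell(\beta_r)$ and $\ell(\beta_{i+1})-\ell(\beta_i)\leq 1$ for each $i$. -}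

module Defs where

open import Data.Nat using (ℕ; zero; suc; _≤_; _<_)
open import Data.Fin using (Fin)
open import Data.Fin.Properties using (all?) renaming (_≟_ to _≟F_)
open import Data.Maybe using (Maybe; just; nothing; _>>=_)
open import Data.Maybe.Properties using () renaming (≡-dec to ≡-decM)
open import Data.Vec using (Vec; []; _∷_; lookup; tabulate)
open import Data.Vec.Properties using () renaming (≡-dec to ≡-decV)
open import Data.List using (List; []; _∷_; map; concatMap; length; filter; allFin)
open import Data.List.Membership.Propositional using (_∈_)
open import Data.List.Relation.Unary.Any using (any?)
open import Data.List.Relation.Binary.Permutation.Propositional using (_↭_)
open import Data.List.Relation.Unary.Linked using (Linked)
open import Data.Product using (_×_; _,_; ∃-syntax)
open import Relation.Binary.PropositionalEquality using (_≡_; _≢_; refl)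
open import Relation.Nullary using (¬_; Dec; yes; no)
open import Relation.Nullary.Decidable using (_×-dec_; _→-dec_; ¬?)

-- Partial maps on the finite set X = Fin m, as the vector of values.
-- `nothing` at position x means "undefined at x".

PMap : ℕ → Set
PMap m = Vec (Maybe (Fin m)) m

IsInjective : ∀ {m} → PMap m → Set
IsInjective {m} f = ∀ (i j : Fin m) → (∃[ y ] (lookup f i ≡ just y × lookup f j ≡ just y)) → i ≡ j

-- Composition "first f, then g"
_⨾_ : ∀ {m} → PMap m → PMap m → PMap m
f ⨾ g = tabulate (λ x → lookup f x >>= lookup g)

idP : ∀ {m} → PMap m
idP = tabulate just

_^P_ : ∀ {m} → PMap m → ℕ → PMap m
α ^P zero = idP
α ^P suc k = α ⨾ (α ^P k)

-- Elements of SIM(B) for B ⊆ X (B given as a list of digits) are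
-- represented as the partial injective maps of X whose domain and
-- range are contained in B (i.e. undefined outside B, values in B).
-- SIM(X) is the case where the only requirement is injectivity.

IsSIM : ∀ {m} → PMap m → Set
IsSIM = IsInjective

IsSIMOn : ∀ {m} → List (Fin m) → PMap m → Set
IsSIMOn {m} B f = IsInjective f
  × (∀ (x : Fin m) → ¬ (x ∈ B) → lookup f x ≡ nothing)
  × (∀ (x y : Fin m) → lookup f x ≡ just y → y ∈ B)

allVecs : ∀ {A : Set} → (n : ℕ) → List A → List (Vec A n)
allVecs zero xs = [] ∷ []
allVecs (suc n) xs = concatMap (λ a → map (a ∷_) (allVecs n xs)) xs

allMaybe : (m : ℕ) → List (Maybe (Fin m))
allMaybe m = nothing ∷ map just (allFin m)

allPMaps : (m : ℕ) → List (PMap m)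
allPMaps m = allVecs m (allMaybe m)

_∈?_ : ∀ {m} (x : Fin m) (xs : List (Fin m)) → Dec (x ∈ xs)
x ∈? xs = any? (x ≟F_) xs

isInjective? : ∀ {m} (f : PMap m) → Dec (IsInjective f)
isInjective? {m} f = all? (λ i → all? (λ j → ex? i j →-dec (i ≟F j)))
  where
  ex? : (i j : Fin m) → Dec (∃[ y ] (lookup f i ≡ just y × lookup f j ≡ just y))
  ex? i j with lookup f i | lookup f j
  ... | nothing | _ = no λ { (_ , () , _) }
  ... | just a | nothing = no λ { (_ , _ , ()) }
  ... | just a | just b with a ≟F b
  ...   | yes refl = yes (a , refl , refl)
  ...   | no a≢b = no λ { (_ , refl , refl) → a≢b refl }

isSIMOn? : ∀ {m} (B : List (Fin m)) (f : PMap m) → Dec (IsSIMOn B f)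
isSIMOn? B f = isInjective? f
  ×-dec all? (λ x → ¬? (x ∈? B) →-dec ≡-decM _≟F_ (lookup f x) nothing)
  ×-dec all? (λ x → all? (λ y → ≡-decM _≟F_ (lookup f x) (just y) →-dec (y ∈? B)))

r : ∀ {m} → ℕ → PMap m → ℕ
r {m} k σ = length (filter (λ α → isInjective? α ×-dec ≡-decV (≡-decM _≟F_) (α ^P k) σ) (allPMaps m))

rOn : ∀ {m} → List (Fin m) → ℕ → PMap m → ℕ
rOn {m} B k α = length (filter (λ β → isSIMOn? B β ×-dec ≡-decV (≡-decM _≟F_) (β ^P k) α) (allPMaps m))

-- Paths. A path [a₁ a₂ ⋯ a_ℓ] is given by its (nonempty, distinct)
-- list of digits; its length ℓ is the length of the list.

Path : ℕ → Set
Path m = List (Fin m)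

ℓ : ∀ {m} → Path m → ℕ
ℓ = length

-- value of the path map at x : a_i ↦ a_{i+1}, undefined elsewhere
pathStepFrom : ∀ {m} → Fin m → List (Fin m) → Fin m → Maybe (Fin m)
pathStepFrom a [] x = nothing
pathStepFrom a (b ∷ rest) x with x ≟F a
... | yes _ = just b
... | no _ = pathStepFrom b rest x

pathStep : ∀ {m} → Path m → Fin m → Maybe (Fin m)
pathStep [] x = nothing
pathStep (a ∷ rest) x = pathStepFrom a rest x

pathsStep : ∀ {m} → List (Path m) → Fin m → Maybe (Fin m)
pathsStep [] x = nothing
pathsStep (p ∷ ps) x with pathStep p x
... | just y = just y
... | nothing = pathsStep ps x

prodPaths : ∀ {m} → List (Path m) → PMap m
prodPaths ps = tabulate (pathsStep ps)

digits : ∀ {m} → List (Path m) → List (Fin m)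
digits ps = concatMap (λ p → p) ps

StepAtMostOne : ℕ → ℕ → Set
StepAtMostOne a b = a ≤ b × b ≤ suc a

WeaklyVarying : ∀ {m} → List (Path m) → Set
WeaklyVarying ps = ∃[ qs ] (qs ↭ ps × Linked StepAtMostOne (map length qs))

-- The key fact (§4) is that an injective k-th root α
-- of σ (k ≥ 1) moves every point x to a point whose σ-trajectory has almost the same
-- length: a σ-step is k α-steps, so the walks after α x are those after x shifted by
-- one α-step, and injectivity of α does the same for the walks ending at α x.  For a
-- product of paths with distinct digits the trajectory of a digit is its path (§5),
-- so every root maps the digits of a group into that group.  Restricting a root to
-- two such blocks and gluing roots on the blocks are inverse bijections (§6, §7),
-- hence root counts multiply over two separated families (§8); induction over the
-- groups gives the theorem.
module Submission where

open import Defs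
open import Data.Nat using (ℕ; zero; suc; _≤_; _<_; _+_; _*_; _∸_; z≤n; s≤s; ∣_-_∣)
open import Data.Nat.Properties using (≤-antisym; <⇒≱; ∣-∣-comm; +-comm; +-suc; *-suc; *-zeroʳ; m≤n+m; m+[n∸m]≡n; +-mono-≤)
open import Data.Fin using (Fin)
open import Data.Fin.Properties using () renaming (_≟_ to _≟F_)
open import Data.Maybe using (Maybe; just; nothing; _>>=_; _<∣>_)
open import Data.Maybe.Properties using (just-injective; <∣>-identityʳ) renaming (≡-dec to ≡-decM)
open import Data.Vec using (Vec; lookup; tabulate) renaming ([] to []ᵥ; _∷_ to _∷ᵥ_)
open import Data.Vec.Properties using (lookup∘tabulate; tabulate∘lookup; tabulate-cong) renaming (≡-dec to ≡-decV; ∷-injective to ∷ᵥ-injective)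
open import Data.List using (List; []; _∷_; _++_; [_]; map; length; concatMap; filter; allFin; cartesianProduct; cartesianProductWith)
open import Data.List.Properties using (concatMap-++; filter-≐; length-++; length-map; length-removeAt′; ++-assoc; ∷-injective)
open import Data.Nat.ListAction using (product)
open import Data.List.Membership.Propositional using (_∈_; _─_)
open import Data.List.Membership.Propositional.Properties using (∈-concat⁺′; ∈-concat⁻′; ∈-map⁺; ∈-map⁻; ∈-allFin; ∈-++⁺ˡ; ∈-++⁺ʳ; ∈-++⁻; ∈-∃++; ∈-filter⁺; ∈-filter⁻; ∈-cartesianProduct⁺; ∈-cartesianProduct⁻)
open import Data.List.Relation.Unary.Any using (here; there)
open import Data.List.Relation.Unary.All as All using (All)
open import Data.List.Relation.Unary.All.Properties using (++⁻ˡ; ++⁻ʳ)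
open import Data.List.Relation.Unary.AllPairs using ([]; _∷_)
open import Data.List.Relation.Unary.Unique.Propositional using (Unique)
open import Data.List.Relation.Binary.Disjoint.Propositional using (Disjoint)
open import Data.List.Relation.Unary.Unique.Propositional.Properties using (cartesianProductWith⁺; cartesianProduct⁺; map⁺; allFin⁺; filter⁺)
open import Data.Product using (_×_; _,_; proj₁; proj₂; ∃-syntax; map₂)
open import Data.Empty using (⊥-elim)
open import Data.Sum using (_⊎_; inj₁; inj₂)
open import Relation.Nullary using (¬_; Dec; yes; no)
open import Relation.Nullary.Decidable using (_×-dec_)
open import Relation.Unary using (Decidable)
open import Function using (_∘_)
open import Relation.Binary.PropositionalEquality using (_≡_; _≢_; refl; sym; trans; cong; cong₂; subst; subst₂; module ≡-Reasoning)

-- §1  Counting: duplicate-free lists in bijection have equal length.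

module _ {A : Set} where

  ∈-─ : ∀ {y z : A} (ys : List A) (y∈ys : y ∈ ys) → z ∈ ys → z ≢ y → z ∈ ys ─ y∈ys
  ∈-─ (_ ∷ ys) (here refl) (here refl) z≢y = ⊥-elim (z≢y refl)
  ∈-─ (_ ∷ ys) (here refl) (there z∈ys) z≢y = z∈ys
  ∈-─ (_ ∷ ys) (there y∈ys) (here refl) z≢y = here refl
  ∈-─ (_ ∷ ys) (there y∈ys) (there z∈ys) z≢y = there (∈-─ ys y∈ys z∈ys z≢y)

injection⇒length≤ : ∀ {A B : Set} (xs : List A) (ys : List B) → Unique xs → (f : A → B) →
  (∀ {x} → x ∈ xs → f x ∈ ys) →
  (∀ {x x'} → x ∈ xs → x' ∈ xs → f x ≡ f x' → x ≡ x') → length xs ≤ length ys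
injection⇒length≤ [] ys _ f maps-to injective = z≤n
injection⇒length≤ (x ∷ xs) ys (x∉xs ∷ uxs) f maps-to injective =
  subst (suc (length xs) ≤_) (sym (length-removeAt′ ys _))
    (s≤s (injection⇒length≤ xs (ys ─ fx∈ys) uxs f maps-to′ (λ a b → injective (there a) (there b))))
  where
  fx∈ys : f x ∈ ys
  fx∈ys = maps-to (here refl)
  maps-to′ : ∀ {x'} → x' ∈ xs → f x' ∈ ys ─ fx∈ys
  maps-to′ x'∈xs = ∈-─ ys fx∈ys (maps-to (there x'∈xs))
    (λ e → All.lookup x∉xs x'∈xs (injective (here refl) (there x'∈xs) (sym e)))

bijection⇒length≡ : ∀ {A B : Set} (xs : List A) (ys : List B) → Unique xs → Unique ys →
  (f : A → B) (g : B → A) →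
  (∀ {x} → x ∈ xs → f x ∈ ys) → (∀ {y} → y ∈ ys → g y ∈ xs) →
  (∀ {x} → x ∈ xs → g (f x) ≡ x) → (∀ {y} → y ∈ ys → f (g y) ≡ y) →
  length xs ≡ length ys
bijection⇒length≡ xs ys uxs uys f g f∈ g∈ gf fg = ≤-antisym
  (injection⇒length≤ xs ys uxs f f∈ λ a b e → trans (sym (gf a)) (trans (cong g e) (gf b)))
  (injection⇒length≤ ys xs uys g g∈ λ a b e → trans (sym (fg a)) (trans (cong f e) (fg b)))

length-cartesianProductWith : ∀ {A B C : Set} (f : A → B → C) (xs : List A) (ys : List B) →
  length (cartesianProductWith f xs ys) ≡ length xs * length ys
length-cartesianProductWith f [] ys = refl
length-cartesianProductWith f (x ∷ xs) ys =
  trans (length-++ (map (f x) ys))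
        (cong₂ _+_ (length-map (f x) ys) (length-cartesianProductWith f xs ys))

-- §2  allPMaps m lists every partial map of Fin m exactly once.

concatMap-rows : ∀ {A B C : Set} (f : A → B → C) (xs : List A) (ys : List B) →
  concatMap (λ a → map (f a) ys) xs ≡ cartesianProductWith f xs ys
concatMap-rows f [] ys = refl
concatMap-rows f (x ∷ xs) ys = cong (map (f x) ys ++_) (concatMap-rows f xs ys)

allVecs-complete : ∀ {A : Set} n (xs : List A) → (∀ a → a ∈ xs) → ∀ (v : Vec A n) → v ∈ allVecs n xs
allVecs-complete zero xs complete []ᵥ = here refl
allVecs-complete (suc n) xs complete (a ∷ᵥ v) =
  ∈-concat⁺′ (∈-map⁺ (a ∷ᵥ_) (allVecs-complete n xs complete v))
             (∈-map⁺ (λ b → map (b ∷ᵥ_) (allVecs n xs)) (complete a))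

allVecs-unique : ∀ {A : Set} n (xs : List A) → Unique xs → Unique (allVecs n xs)
allVecs-unique zero xs uxs = All.[] ∷ []
allVecs-unique (suc n) xs uxs = subst Unique (sym (concatMap-rows _∷ᵥ_ xs (allVecs n xs)))
  (cartesianProductWith⁺ _∷ᵥ_ ∷ᵥ-injective uxs (allVecs-unique n xs uxs))

allMaybe-complete : ∀ m (a : Maybe (Fin m)) → a ∈ allMaybe m
allMaybe-complete m nothing = here refl
allMaybe-complete m (just i) = there (∈-map⁺ just (∈-allFin i))

allMaybe-unique : ∀ m → Unique (allMaybe m)
allMaybe-unique m = All.tabulate nothing∉ ∷ map⁺ just-injective (allFin⁺ m)
  where
  nothing∉ : ∀ {z} → z ∈ map just (allFin m) → nothing ≢ z
  nothing∉ z∈ with ∈-map⁻ just z∈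
  ... | _ , _ , refl = λ ()

allPMaps-complete : ∀ m (f : PMap m) → f ∈ allPMaps m
allPMaps-complete m = allVecs-complete m (allMaybe m) (allMaybe-complete m)

allPMaps-unique : ∀ m → Unique (allPMaps m)
allPMaps-unique m = allVecs-unique m (allMaybe m) (allMaybe-unique m)

-- §3  Powers of a partial map, computed pointwise by iteration.

module _ {m : ℕ} where

  iter : PMap m → ℕ → Fin m → Maybe (Fin m)
  iter f zero x = just x
  iter f (suc t) x = lookup f x >>= iter f t

  nothing≢just : ∀ {v : Fin m} → nothing ≢ just v
  nothing≢just ()

  Defined : PMap m → ℕ → Fin m → Set
  Defined f t x = ∃[ z ] iter f t x ≡ just z

  >>=-cong : ∀ (a : Maybe (Fin m)) {g h : Fin m → Maybe (Fin m)} → (∀ y → g y ≡ h y) → (a >>= g) ≡ (a >>= h)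
  >>=-cong nothing g≗h = refl
  >>=-cong (just y) g≗h = g≗h y

  lookup-^P : ∀ f t x → lookup (f ^P t) x ≡ iter f t x
  lookup-^P f zero x = lookup∘tabulate just x
  lookup-^P f (suc t) x =
    trans (lookup∘tabulate (λ z → lookup f z >>= lookup (f ^P t)) x) (>>=-cong (lookup f x) (lookup-^P f t))

  pmap-ext : ∀ {u v : PMap m} → (∀ x → lookup u x ≡ lookup v x) → u ≡ v
  pmap-ext {u} {v} u≗v = trans (sym (tabulate∘lookup u)) (trans (tabulate-cong u≗v) (tabulate∘lookup v))

  ^P≡⇒iter : ∀ {β τ : PMap m} k → β ^P k ≡ τ → ∀ z → iter β k z ≡ lookup τ z
  ^P≡⇒iter {β} k βᵏ≡τ z = trans (sym (lookup-^P β k z)) (cong (λ v → lookup v z) βᵏ≡τ)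

  iter⇒^P≡ : ∀ {β τ : PMap m} k → (∀ z → iter β k z ≡ lookup τ z) → β ^P k ≡ τ
  iter⇒^P≡ {β} k βᵏ≗τ = pmap-ext λ z → trans (lookup-^P β k z) (βᵏ≗τ z)

  iter-+ : ∀ f s t x → iter f (s + t) x ≡ (iter f s x >>= iter f t)
  iter-+ f zero t x = refl
  iter-+ f (suc s) t x with lookup f x
  ... | nothing = refl
  ... | just y = iter-+ f s t y

  iter-one : ∀ f x → iter f 1 x ≡ lookup f x
  iter-one f x with lookup f x
  ... | nothing = refl
  ... | just y = refl

  iter-split : ∀ f s t x {v} → iter f (s + t) x ≡ just v → ∃[ u ] (iter f s x ≡ just u × iter f t u ≡ just v)
  iter-split f s t x fˢ⁺ᵗx≡v with iter f s x | iter-+ f s t x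
  ... | nothing | e = ⊥-elim (nothing≢just (trans (sym e) fˢ⁺ᵗx≡v))
  ... | just u | e = u , refl , trans (sym e) fˢ⁺ᵗx≡v

  defined-≤ : ∀ f {s s'} x → s ≤ s' → Defined f s' x → Defined f s x
  defined-≤ f {s} {s'} x s≤s' (v , fˢ'x≡v) with iter-split f s (s' ∸ s) x
    (subst (λ n → iter f n x ≡ just v) (sym (m+[n∸m]≡n s≤s')) fˢ'x≡v)
  ... | u , fˢx≡u , _ = u , fˢx≡u

∣m-n∣≤1 : ∀ {m n} → m ≤ suc n → n ≤ suc m → ∣ m - n ∣ ≤ 1
∣m-n∣≤1 {zero} {zero} _ _ = z≤n
∣m-n∣≤1 {zero} {suc n} _ (s≤s n≤0) = s≤s n≤0
∣m-n∣≤1 {suc m} {zero} (s≤s m≤0) _ = s≤s m≤0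
∣m-n∣≤1 {suc m} {suc n} (s≤s m≤1+n) (s≤s n≤1+m) = ∣m-n∣≤1 m≤1+n n≤1+m

-- §4  Key lemma: an injective root moves points between σ-trajectories of almost equal length.

module _ {m : ℕ} where

  -- For a
  -- digit of a path, before + 1 + after is the length of the path.
  record Position (σ : PMap m) (x : Fin m) : Set where
    field
      after : ℕ
      after-defined : Defined σ after x
      after-max : ∀ t → Defined σ t x → t ≤ after
      before : ℕ
      before-reached : ∃[ w ] iter σ before w ≡ just x
      before-max : ∀ t {w} → iter σ t w ≡ just x → t ≤ before

    trajectory : ℕ
    trajectory = before + suc after

  module InjectiveRoot {α σ : PMap m} (k' : ℕ) (α-root : α ^P suc k' ≡ σ) (α-inj : IsInjective α) where

    k : ℕ
    k = suc k'

    σ-iter : ∀ t z → iter σ t z ≡ iter α (k * t) z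
    σ-iter zero z = cong (λ n → iter α n z) (sym (*-zeroʳ k))
    σ-iter (suc t) z = begin
      (lookup σ z >>= iter σ t)        ≡⟨ cong (_>>= iter σ t) (sym (^P≡⇒iter {β = α} k α-root z)) ⟩
      (iter α k z >>= iter σ t)        ≡⟨ >>=-cong (iter α k z) (σ-iter t) ⟩
      (iter α k z >>= iter α (k * t))  ≡⟨ sym (iter-+ α k (k * t) z) ⟩
      iter α (k + k * t) z             ≡⟨ cong (λ n → iter α n z) (sym (*-suc k t)) ⟩
      iter α (k * suc t) z             ∎
      where open ≡-Reasoning

    σ⇒α : ∀ t z {v} → iter σ t z ≡ just v → iter α (k * t) z ≡ just v
    σ⇒α t z σᵗz≡v = trans (sym (σ-iter t z)) σᵗz≡v

    α⇒σ : ∀ t z {v} → iter α (k * t) z ≡ just v → iter σ t z ≡ just v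
    α⇒σ t z αᵏᵗz≡v = trans (σ-iter t z) αᵏᵗz≡v

    -- If α x = y, the σ-trajectories through x and y have lengths differing by at most one:
    -- y is as far from the end as x or one step closer, and as far from the start or one further.
    module Step {x y : Fin m} (αx≡y : lookup α x ≡ just y) (px : Position σ x) (py : Position σ y) where
      open Position px using () renaming (after to P; before to a)
      open Position py using () renaming (after to Q; before to b)

      shift : ∀ t → iter α (suc t) x ≡ iter α t y
      shift t = cong (_>>= iter α t) αx≡y

      Q≤P : Q ≤ P
      Q≤P = Position.after-max px Q (map₂ (α⇒σ Q x) αᵏᵠx)
        where
        αᵏᵠx : Defined α (k * Q) x
        αᵏᵠx = defined-≤ α x (m≤n+m (k * Q) 1)
          (map₂ (λ e → trans (shift (k * Q)) (σ⇒α Q y e)) (Position.after-defined py))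

      P≤1+Q : P ≤ suc Q
      P≤1+Q = bound P (Position.after-defined px)
        where
        bound : ∀ n → Defined σ n x → n ≤ suc Q
        bound zero _ = z≤n
        bound (suc t) (v , σⁿx≡v) = s≤s (Position.after-max py t (map₂ (α⇒σ t y) αᵏᵗy))
          where
          αᵏᵗy : Defined α (k * t) y
          αᵏᵗy = map₂ (trans (sym (shift (k * t))))
            (defined-≤ α x (subst (suc (k * t) ≤_) (sym (*-suc k t)) (s≤s (m≤n+m (k * t) k')))
              (v , σ⇒α (suc t) x σⁿx≡v))

      a≤b : a ≤ b
      a≤b with Position.before-reached px
      ... | w , σᵃw≡x with iter-split α 1 (k * a) w (subst (λ n → iter α n w ≡ just y) (+-comm (k * a) 1) αᵏᵃ⁺¹w≡y)
        where
        αᵏᵃ⁺¹w≡y : iter α (k * a + 1) w ≡ just y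
        αᵏᵃ⁺¹w≡y = begin
          iter α (k * a + 1) w              ≡⟨ iter-+ α (k * a) 1 w ⟩
          (iter α (k * a) w >>= iter α 1)   ≡⟨ cong (_>>= iter α 1) (σ⇒α a w σᵃw≡x) ⟩
          iter α 1 x                        ≡⟨ iter-one α x ⟩
          lookup α x                        ≡⟨ αx≡y ⟩
          just y                            ∎
          where open ≡-Reasoning
      ... | u , _ , αᵏᵃu≡y = Position.before-max py a (α⇒σ a u αᵏᵃu≡y)

      b≤1+a : b ≤ suc a
      b≤1+a = bound b (proj₂ (Position.before-reached py))
        where
        bound : ∀ n {w} → iter σ n w ≡ just y → n ≤ suc a
        bound zero _ = z≤n
        bound (suc t) {w} σⁿw≡y
          with iter-split α (k' + k * t) 1 w (subst (λ n → iter α n w ≡ just y) k[1+t]≡ (σ⇒α (suc t) w σⁿw≡y))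
          where
          k[1+t]≡ : k * suc t ≡ k' + k * t + 1
          k[1+t]≡ = trans (*-suc k t) (+-comm 1 (k' + k * t))
        ... | v , αᵏ'⁺ᵏᵗw≡v , αv≡y with α-inj v x (y , trans (sym (iter-one α v)) αv≡y , αx≡y)
        ...   | refl with iter-split α k' (k * t) w αᵏ'⁺ᵏᵗw≡v
        ...     | u , _ , αᵏᵗu≡x = s≤s (Position.before-max px t (α⇒σ t u αᵏᵗu≡x))

      trajectory-close : ∣ Position.trajectory px - Position.trajectory py ∣ ≤ 1
      trajectory-close = ∣m-n∣≤1
        (subst (a + suc P ≤_) (+-suc b (suc Q)) (+-mono-≤ a≤b (s≤s P≤1+Q)))
        (+-mono-≤ b≤1+a (s≤s Q≤P))

-- §5  For a product of paths with distinct digits, the σ-trajectory of a digit is its path.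

module _ {A : Set} where

  Unique-++⁻ : ∀ (xs ys : List A) → Unique (xs ++ ys) → Unique xs × Unique ys × Disjoint xs ys
  Unique-++⁻ [] ys uys = [] , uys , λ ()
  Unique-++⁻ (x ∷ xs) ys (x∉xs++ys ∷ u) with Unique-++⁻ xs ys u
  ... | uxs , uys , disjoint = (++⁻ˡ xs x∉xs++ys ∷ uxs) , uys , disjoint′
    where
    disjoint′ : Disjoint (x ∷ xs) ys
    disjoint′ (here refl , z∈ys) = All.lookup (++⁻ʳ xs x∉xs++ys) z∈ys refl
    disjoint′ (there z∈xs , z∈ys) = disjoint (z∈xs , z∈ys)

  ∉-++ : ∀ {x : A} {xs ys} → ¬ x ∈ xs → ¬ x ∈ ys → ¬ x ∈ xs ++ ys
  ∉-++ {xs = xs} x∉xs x∉ys x∈ with ∈-++⁻ xs x∈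
  ... | inj₁ x∈xs = x∉xs x∈xs
  ... | inj₂ x∈ys = x∉ys x∈ys

  ∈-middle : ∀ (pre : List A) {y} post → y ∈ pre ++ y ∷ post
  ∈-middle pre post = ∈-++⁺ʳ pre (here refl)

  unique-position : ∀ (pre post pre' post' : List A) {y} → Unique (pre ++ y ∷ post) →
    pre ++ y ∷ post ≡ pre' ++ y ∷ post' → pre ≡ pre' × post ≡ post'
  unique-position [] post [] post' _ e = refl , proj₂ (∷-injective e)
  unique-position [] post (c ∷ pre') post' (y∉ ∷ _) e with ∷-injective e
  ... | refl , e′ = ⊥-elim (All.lookup y∉ (subst (_ ∈_) (sym e′) (∈-middle pre' post')) refl)
  unique-position (c ∷ pre) post [] post' (c∉ ∷ _) e with ∷-injective e
  ... | refl , _ = ⊥-elim (All.lookup c∉ (∈-middle pre post) refl)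
  unique-position (c ∷ pre) post (c' ∷ pre') post' (_ ∷ u) e with ∷-injective e
  ... | refl , e′ with unique-position pre post pre' post' u e′
  ...   | refl , post≡post' = refl , post≡post'


module _ {m : ℕ} where

  pathStep-skip : ∀ {x c : Fin m} (l : List (Fin m)) → x ≢ c → pathStep (c ∷ l) x ≡ pathStep l x
  pathStep-skip [] x≢c = refl
  pathStep-skip {x} {c} (b ∷ l) x≢c with x ≟F c
  ... | yes x≡c = ⊥-elim (x≢c x≡c)
  ... | no _ = refl

  pathStep-next : ∀ (pre : List (Fin m)) {x y} post → Unique (pre ++ x ∷ y ∷ post) →
    pathStep (pre ++ x ∷ y ∷ post) x ≡ just y
  pathStep-next [] {x} post _ with x ≟F x
  ... | yes _ = refl
  ... | no x≢x = ⊥-elim (x≢x refl)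
  pathStep-next (c ∷ pre) {x} post (c∉ ∷ u) =
    trans (pathStep-skip (pre ++ x ∷ _ ∷ post) (λ x≡c → All.lookup c∉ (∈-middle pre _) (sym x≡c)))
          (pathStep-next pre post u)

  pathStepFrom-next⁻ : ∀ (c : Fin m) rest {x y} → pathStepFrom c rest x ≡ just y →
    ∃[ pre ] ∃[ post ] (c ∷ rest ≡ pre ++ x ∷ y ∷ post)
  pathStepFrom-next⁻ c [] ()
  pathStepFrom-next⁻ c (b ∷ rest) {x} e with x ≟F c
  pathStepFrom-next⁻ c (b ∷ rest) refl | yes refl = [] , rest , refl
  ... | no _ with pathStepFrom-next⁻ b rest e
  ...   | pre , post , e′ = c ∷ pre , post , cong (c ∷_) e′

  pathStep-next⁻ : ∀ (p : Path m) {x y} → pathStep p x ≡ just y → ∃[ pre ] ∃[ post ] (p ≡ pre ++ x ∷ y ∷ post)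
  pathStep-next⁻ [] ()
  pathStep-next⁻ (c ∷ rest) = pathStepFrom-next⁻ c rest

  pathStep-domain : ∀ (p : Path m) {x y} → pathStep p x ≡ just y → x ∈ p
  pathStep-domain p e with pathStep-next⁻ p e
  ... | pre , post , refl = ∈-middle pre _

  Adjacent : List (Path m) → Fin m → Fin m → Set
  Adjacent ps x y = ∃[ p ] ∃[ pre ] ∃[ post ] (p ∈ ps × p ≡ pre ++ x ∷ y ∷ post)

  Occurs : List (Path m) → Fin m → Set
  Occurs ps x = ∃[ p ] ∃[ pre ] ∃[ post ] (p ∈ ps × p ≡ pre ++ x ∷ post)

  occurs⇒digit : ∀ {ps x} → Occurs ps x → x ∈ digits ps
  occurs⇒digit (p , pre , post , p∈ps , refl) = ∈-concat⁺′ (∈-middle pre post) (∈-map⁺ (λ q → q) p∈ps)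

  digit⇒occurs : ∀ (ps : List (Path m)) {x} → x ∈ digits ps → Occurs ps x
  digit⇒occurs ps x∈ with ∈-concat⁻′ (map (λ q → q) ps) x∈
  ... | p , x∈p , p∈ with ∈-map⁻ (λ q → q) p∈
  ...   | p , p∈ps , refl with ∈-∃++ x∈p
  ...     | pre , post , e = p , pre , post , p∈ps , e

  pathsStep⇒adjacent : ∀ (ps : List (Path m)) {x y} → pathsStep ps x ≡ just y → Adjacent ps x y
  pathsStep⇒adjacent [] ()
  pathsStep⇒adjacent (p ∷ ps) {x} e with pathStep p x in pₓ
  pathsStep⇒adjacent (p ∷ ps) refl | just y with pathStep-next⁻ p pₓ
  ... | pre , post , e′ = p , pre , post , here refl , e′
  pathsStep⇒adjacent (p ∷ ps) e | nothing with pathsStep⇒adjacent ps e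
  ... | q , pre , post , q∈ps , e′ = q , pre , post , there q∈ps , e′

  pathsStep-here : ∀ (p : Path m) ps {x y} → pathStep p x ≡ just y → pathsStep (p ∷ ps) x ≡ just y
  pathsStep-here p ps {x} pₓ≡y rewrite pₓ≡y = refl

  adjacent⇒pathsStep : ∀ (ps : List (Path m)) {x y} → Unique (digits ps) → Adjacent ps x y → pathsStep ps x ≡ just y
  adjacent⇒pathsStep (p ∷ ps) u (_ , pre , post , here refl , refl) =
    pathsStep-here p ps (pathStep-next pre post (proj₁ (Unique-++⁻ p (digits ps) u)))
  adjacent⇒pathsStep (p ∷ ps) {x} u (q , pre , post , there q∈ps , refl) with pathStep p x in pₓ
  ... | just _ = ⊥-elim (proj₂ (proj₂ (Unique-++⁻ p (digits ps) u))
                  (pathStep-domain p pₓ , occurs⇒digit (q , pre , _ , q∈ps , refl)))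
  ... | nothing =
    adjacent⇒pathsStep ps (proj₁ (proj₂ (Unique-++⁻ p (digits ps) u))) (q , pre , post , q∈ps , refl)

  occurrence-unique : ∀ (ps : List (Path m)) {y} → Unique (digits ps) →
    ((p , pre , post , _) (p' , pre' , post' , _) : Occurs ps y) → pre ≡ pre' × post ≡ post'
  occurrence-unique (p ∷ ps) u (_ , pre , post , here refl , refl) (_ , pre' , post' , here refl , e) =
    unique-position pre post pre' post' (proj₁ (Unique-++⁻ _ (digits ps) u)) e
  occurrence-unique (p ∷ ps) u (_ , pre , post , here refl , refl) (q , pre' , post' , there q∈ps , refl) =
    ⊥-elim (proj₂ (proj₂ (Unique-++⁻ _ (digits ps) u))
      (∈-middle pre post , occurs⇒digit (q , pre' , post' , q∈ps , refl)))
  occurrence-unique (p ∷ ps) u (q , pre , post , there q∈ps , refl) (_ , pre' , post' , here refl , refl) =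
    ⊥-elim (proj₂ (proj₂ (Unique-++⁻ _ (digits ps) u))
      (∈-middle pre' post' , occurs⇒digit (q , pre , post , q∈ps , refl)))
  occurrence-unique (p ∷ ps) u (q , pre , post , there q∈ps , e) (q' , pre' , post' , there q'∈ps , e') =
    occurrence-unique ps (proj₁ (proj₂ (Unique-++⁻ p (digits ps) u))) (q , pre , post , q∈ps , e) (q' , pre' , post' , q'∈ps , e')

-- For a family of paths with distinct digits, the position of a digit x of a path
-- p = pre ++ x ∷ post on its σ-trajectory is (length pre, length post), so its
-- trajectory has length ℓ p.
module PathFamily {m : ℕ} (ps : List (Path m)) (u : Unique (digits ps)) where

  σ : PMap m
  σ = prodPaths ps

  σ-next : ∀ {x y} → Adjacent ps x y → lookup σ x ≡ just y
  σ-next adj = trans (lookup∘tabulate (pathsStep ps) _) (adjacent⇒pathsStep ps u adj)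

  σ-next⁻ : ∀ {x y} → lookup σ x ≡ just y → Adjacent ps x y
  σ-next⁻ {x} e = pathsStep⇒adjacent ps (trans (sym (lookup∘tabulate (pathsStep ps) x)) e)

  σ-last : ∀ {p} pre {x} → p ∈ ps → p ≡ pre ++ [ x ] → lookup σ x ≡ nothing
  σ-last pre {x} p∈ps p≡ with lookup σ x in σx
  ... | nothing = refl
  ... | just y with σ-next⁻ σx
  ...   | q , pre' , post' , q∈ps , q≡ with occurrence-unique ps u (_ , pre , [] , p∈ps , p≡) (q , pre' , _ , q∈ps , q≡)
  ...     | _ , ()

  walk : ∀ {p} pre {w} mid {x} post → p ∈ ps → p ≡ pre ++ w ∷ mid ++ x ∷ post →
    iter σ (suc (length mid)) w ≡ just x
  walk pre [] post p∈ps p≡ = trans (iter-one σ _) (σ-next (_ , pre , post , p∈ps , p≡))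
  walk pre {w} (v ∷ mid) post p∈ps p≡ =
    trans (cong (_>>= iter σ (suc (length mid))) (σ-next (_ , pre , _ , p∈ps , p≡)))
          (walk (pre ++ [ w ]) mid post p∈ps (trans p≡ (sym (++-assoc pre [ w ] _))))

  after-defined : ∀ {p} pre {x} post → p ∈ ps → p ≡ pre ++ x ∷ post → Defined σ (length post) x
  after-defined pre {x} [] p∈ps p≡ = x , refl
  after-defined pre {x} (y ∷ post) p∈ps p≡ =
    map₂ (trans (cong (_>>= iter σ (length post)) (σ-next (_ , pre , post , p∈ps , p≡))))
         (after-defined (pre ++ [ x ]) post p∈ps (trans p≡ (sym (++-assoc pre [ x ] _))))

  after-max : ∀ t {p} pre {x} post → p ∈ ps → p ≡ pre ++ x ∷ post → Defined σ t x → t ≤ length post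
  after-max zero pre post p∈ps p≡ _ = z≤n
  after-max (suc t) pre [] p∈ps p≡ (v , σˢᵗx≡v) =
    ⊥-elim (nothing≢just (trans (sym (cong (_>>= iter σ t) (σ-last pre p∈ps p≡))) σˢᵗx≡v))
  after-max (suc t) pre {x} (y ∷ post) p∈ps p≡ (v , σˢᵗx≡v) =
    s≤s (after-max t (pre ++ [ x ]) post p∈ps (trans p≡ (sym (++-assoc pre [ x ] _)))
      (v , trans (sym (cong (_>>= iter σ t) (σ-next (_ , pre , post , p∈ps , p≡)))) σˢᵗx≡v))

  -- The longest σ-walk ending at x = p[|pre|] starts at the head of p and has |pre| steps;
  -- maximality uses that x occurs only once.
  before-reached : ∀ {p} pre {x} post → p ∈ ps → p ≡ pre ++ x ∷ post → ∃[ w ] iter σ (length pre) w ≡ just x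
  before-reached [] {x} post p∈ps p≡ = x , refl
  before-reached (w ∷ pre) post p∈ps p≡ = w , walk [] pre post p∈ps p≡

  before-max : ∀ t {p} pre {y} post → p ∈ ps → p ≡ pre ++ y ∷ post → ∀ {w} → iter σ t w ≡ just y → t ≤ length pre
  before-max zero pre post p∈ps p≡ _ = z≤n
  before-max (suc t) pre {y} post p∈ps p≡ {w} σˢᵗw≡y
    with iter-split σ t 1 w (subst (λ n → iter σ n w ≡ just y) (+-comm 1 t) σˢᵗw≡y)
  ... | v , σᵗw≡v , σv≡y with σ-next⁻ (trans (sym (iter-one σ v)) σv≡y)
  ...   | q , pre' , post' , q∈ps , q≡
    with occurrence-unique ps u (_ , pre , post , p∈ps , p≡)
                                (q , pre' ++ [ v ] , post' , q∈ps , trans q≡ (sym (++-assoc pre' [ v ] _)))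
  ...     | refl , _ = subst (suc t ≤_) (sym (trans (length-++ pre' {[ v ]}) (+-comm (length pre') 1)))
                         (s≤s (before-max t pre' (y ∷ post') q∈ps q≡ σᵗw≡v))

  position : ∀ {p} pre {x} post → p ∈ ps → p ≡ pre ++ x ∷ post → Position σ x
  position pre post p∈ps p≡ = record
    { after = length post
    ; after-defined = after-defined pre post p∈ps p≡
    ; after-max = λ t → after-max t pre post p∈ps p≡
    ; before = length pre
    ; before-reached = before-reached pre post p∈ps p≡
    ; before-max = λ t → before-max t pre post p∈ps p≡
    }

  trajectory-length : ∀ {p} pre {x} post (p∈ps : p ∈ ps) (p≡ : p ≡ pre ++ x ∷ post) →
    Position.trajectory (position pre post p∈ps p≡) ≡ ℓ p
  trajectory-length pre post p∈ps refl = sym (length-++ pre)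

  root-step-length : ∀ k' α → α ^P suc k' ≡ σ → IsInjective α → ∀ {x y} → lookup α x ≡ just y →
    ∀ {p q} pre post pre' post' → p ∈ ps → q ∈ ps → p ≡ pre ++ x ∷ post → q ≡ pre' ++ y ∷ post' →
    ∣ ℓ p - ℓ q ∣ ≤ 1
  root-step-length k' α α-root α-inj αx≡y pre post pre' post' p∈ps q∈ps p≡ q≡ =
    subst (λ n → n ≤ 1)
      (cong₂ ∣_-_∣ (trajectory-length pre post p∈ps p≡) (trajectory-length pre' post' q∈ps q≡))
      (Step.trajectory-close αx≡y (position pre post p∈ps p≡) (position pre' post' q∈ps q≡))
    where open InjectiveRoot {α = α} k' α-root α-inj

-- §6  Restricting a partial map to a block, and gluing maps on disjoint blocks.

module _ {m : ℕ} where

  SupportedOn : List (Fin m) → PMap m → Set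
  SupportedOn B β = ∀ x → ¬ x ∈ B → lookup β x ≡ nothing

  Preserves : List (Fin m) → PMap m → Set
  Preserves B β = ∀ x y → x ∈ B → lookup β x ≡ just y → y ∈ B

  restrictAt : List (Fin m) → PMap m → Fin m → Maybe (Fin m)
  restrictAt B β x with x ∈? B
  ... | yes _ = lookup β x
  ... | no _ = nothing

  restrict : List (Fin m) → PMap m → PMap m
  restrict B β = tabulate (restrictAt B β)

  union : PMap m → PMap m → PMap m
  union β₁ β₂ = tabulate (λ x → lookup β₁ x <∣> lookup β₂ x)

  restrict-∈ : ∀ B β {x} → x ∈ B → lookup (restrict B β) x ≡ lookup β x
  restrict-∈ B β {x} x∈B with x ∈? B | lookup∘tabulate (restrictAt B β) x
  ... | yes _ | e = e
  ... | no x∉B | _ = ⊥-elim (x∉B x∈B)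

  restrict-supported : ∀ B β → SupportedOn B (restrict B β)
  restrict-supported B β x x∉B with x ∈? B | lookup∘tabulate (restrictAt B β) x
  ... | yes x∈B | _ = ⊥-elim (x∉B x∈B)
  ... | no _ | e = e

  restrict-defined : ∀ B β {x y} → lookup (restrict B β) x ≡ just y → x ∈ B × lookup β x ≡ just y
  restrict-defined B β {x} e with x ∈? B
  ... | yes x∈B = x∈B , trans (sym (restrict-∈ B β x∈B)) e
  ... | no x∉B = ⊥-elim (nothing≢just (trans (sym (restrict-supported B β x x∉B)) e))

  union-at : ∀ β₁ β₂ x → lookup (union β₁ β₂) x ≡ (lookup β₁ x <∣> lookup β₂ x)
  union-at β₁ β₂ x = lookup∘tabulate (λ z → lookup β₁ z <∣> lookup β₂ z) x

  restrict-agrees : ∀ B {γ β} → (∀ {x} → x ∈ B → lookup γ x ≡ lookup β x) → SupportedOn B β → restrict B γ ≡ β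
  restrict-agrees B {γ} {β} agree β-supp = pmap-ext λ x → pointwise x (x ∈? B)
    where
    pointwise : ∀ x → Dec (x ∈ B) → lookup (restrict B γ) x ≡ lookup β x
    pointwise x (yes x∈B) = trans (restrict-∈ B γ x∈B) (agree x∈B)
    pointwise x (no x∉B) = trans (restrict-supported B γ x x∉B) (sym (β-supp x x∉B))

  module Glue {B₁ B₂ : List (Fin m)} (disjoint : Disjoint B₁ B₂) (β₁ β₂ : PMap m)
    (β₁-supp : SupportedOn B₁ β₁) (β₂-supp : SupportedOn B₂ β₂) where

    union-left : ∀ {x} → x ∈ B₁ → lookup (union β₁ β₂) x ≡ lookup β₁ x
    union-left {x} x∈B₁ = trans (union-at β₁ β₂ x)
      (trans (cong (lookup β₁ x <∣>_) (β₂-supp x (λ x∈B₂ → disjoint (x∈B₁ , x∈B₂)))) (<∣>-identityʳ _))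

    union-right : ∀ {x} → x ∈ B₂ → lookup (union β₁ β₂) x ≡ lookup β₂ x
    union-right {x} x∈B₂ = trans (union-at β₁ β₂ x)
      (cong (_<∣> lookup β₂ x) (β₁-supp x (λ x∈B₁ → disjoint (x∈B₁ , x∈B₂))))

    union-supported : SupportedOn (B₁ ++ B₂) (union β₁ β₂)
    union-supported x x∉B = trans (union-at β₁ β₂ x)
      (cong₂ _<∣>_ (β₁-supp x (x∉B ∘ ∈-++⁺ˡ)) (β₂-supp x (x∉B ∘ ∈-++⁺ʳ B₁)))

    union-defined : ∀ {x y} → lookup (union β₁ β₂) x ≡ just y →
      (x ∈ B₁ × lookup β₁ x ≡ just y) ⊎ (x ∈ B₂ × lookup β₂ x ≡ just y)
    union-defined {x} e with x ∈? B₁ | x ∈? B₂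
    ... | yes x∈B₁ | _ = inj₁ (x∈B₁ , trans (sym (union-left x∈B₁)) e)
    ... | no _ | yes x∈B₂ = inj₂ (x∈B₂ , trans (sym (union-right x∈B₂)) e)
    ... | no x∉B₁ | no x∉B₂ = ⊥-elim (nothing≢just (trans (sym (union-supported x (∉-++ x∉B₁ x∉B₂))) e))

    restrict-union₁ : restrict B₁ (union β₁ β₂) ≡ β₁
    restrict-union₁ = restrict-agrees B₁ (λ x∈B₁ → union-left x∈B₁) β₁-supp

    restrict-union₂ : restrict B₂ (union β₁ β₂) ≡ β₂
    restrict-union₂ = restrict-agrees B₂ (λ x∈B₂ → union-right x∈B₂) β₂-supp

  union-restrict : ∀ {B₁ B₂} → Disjoint B₁ B₂ → ∀ {β} → SupportedOn (B₁ ++ B₂) β →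
    union (restrict B₁ β) (restrict B₂ β) ≡ β
  union-restrict {B₁} {B₂} disjoint {β} β-supp = pmap-ext λ x → pointwise x (x ∈? B₁) (x ∈? B₂)
    where
    open Glue disjoint (restrict B₁ β) (restrict B₂ β) (restrict-supported B₁ β) (restrict-supported B₂ β)
    pointwise : ∀ x → Dec (x ∈ B₁) → Dec (x ∈ B₂) → lookup (union (restrict B₁ β) (restrict B₂ β)) x ≡ lookup β x
    pointwise x (yes x∈B₁) _ = trans (union-left x∈B₁) (restrict-∈ B₁ β x∈B₁)
    pointwise x (no _) (yes x∈B₂) = trans (union-right x∈B₂) (restrict-∈ B₂ β x∈B₂)
    pointwise x (no x∉B₁) (no x∉B₂) = trans (union-supported x x∉B) (sym (β-supp x x∉B))
      where
      x∉B : ¬ x ∈ B₁ ++ B₂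
      x∉B = ∉-++ x∉B₁ x∉B₂

  iter-agree : ∀ γ β B → (∀ {x} → x ∈ B → lookup γ x ≡ lookup β x) → Preserves B β →
    ∀ t x → x ∈ B → iter γ t x ≡ iter β t x
  iter-agree γ β B agree preserves zero x x∈B = refl
  iter-agree γ β B agree preserves (suc t) x x∈B with lookup β x in βx | agree x∈B
  ... | nothing | γx≡nothing rewrite γx≡nothing = refl
  ... | just y | γx≡y rewrite γx≡y = iter-agree γ β B agree preserves t y (preserves x y x∈B βx)

  iter-outside : ∀ {B} β → SupportedOn B β → ∀ t {x} → ¬ x ∈ B → iter β (suc t) x ≡ nothing
  iter-outside β β-supp t {x} x∉B = cong (_>>= iter β t) (β-supp x x∉B)

-- §7  Root counts multiply over blocks that every root maps into themselves.

module Roots {m : ℕ} (k' : ℕ) where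

  k : ℕ
  k = suc k'

  Root : List (Fin m) → PMap m → PMap m → Set
  Root B τ β = IsSIMOn B β × β ^P k ≡ τ

  root? : ∀ B τ → Decidable (Root B τ)
  root? B τ β = isSIMOn? B β ×-dec ≡-decV (≡-decM _≟F_) (β ^P k) τ

  roots : List (Fin m) → PMap m → List (PMap m)
  roots B τ = filter (root? B τ) (allPMaps m)

  roots-unique : ∀ B τ → Unique (roots B τ)
  roots-unique B τ = filter⁺ (root? B τ) (allPMaps-unique m)

  root∈roots : ∀ {B τ β} → Root B τ β → β ∈ roots B τ
  root∈roots {B} {τ} {β} root = ∈-filter⁺ (root? B τ) (allPMaps-complete m β) root

  roots⇒root : ∀ {B τ β} → β ∈ roots B τ → Root B τ β
  roots⇒root {B} {τ} β∈ = proj₂ (∈-filter⁻ (root? B τ) {xs = allPMaps m} β∈)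

  restrict-root : ∀ B β {τ τ'} → IsInjective β → β ^P k ≡ τ → Preserves B β →
    SupportedOn B τ' → (∀ {z} → z ∈ B → lookup τ z ≡ lookup τ' z) → Root B τ' (restrict B β)
  restrict-root B β {τ} {τ'} β-inj βᵏ≡τ preserves τ'-supp agree =
    (injective , restrict-supported B β , values) , iter⇒^P≡ {β = restrict B β} k power
    where
    injective : IsInjective (restrict B β)
    injective i j (y , e₁ , e₂) = β-inj i j (y , proj₂ (restrict-defined B β e₁) , proj₂ (restrict-defined B β e₂))
    values : ∀ x y → lookup (restrict B β) x ≡ just y → y ∈ B
    values x y e = preserves x y (proj₁ (restrict-defined B β e)) (proj₂ (restrict-defined B β e))
    power : ∀ z → iter (restrict B β) k z ≡ lookup τ' z
    power z with z ∈? B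
    ... | yes z∈B = trans (iter-agree (restrict B β) β B (restrict-∈ B β) preserves k z z∈B)
                          (trans (^P≡⇒iter {β = β} k βᵏ≡τ z) (agree z∈B))
    ... | no z∉B = trans (iter-outside (restrict B β) (restrict-supported B β) k' z∉B) (sym (τ'-supp z z∉B))

  -- Roots of τ₁ in SIM(B₁) and of τ₂ in
  -- SIM(B₂) glue to a root of their union in SIM(B₁ ++ B₂); when every root of the union
  -- maps each block into itself, this is a bijection, so the root counts multiply.
  module Blocks {B₁ B₂ : List (Fin m)} (disjoint : Disjoint B₁ B₂) {τ₁ τ₂ : PMap m}
    (τ₁-supp : SupportedOn B₁ τ₁) (τ₂-supp : SupportedOn B₂ τ₂) where

    τ : PMap m
    τ = union τ₁ τ₂

    open Glue disjoint τ₁ τ₂ τ₁-supp τ₂-supp using ()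
      renaming (union-left to τ-left; union-right to τ-right; union-supported to τ-supported)

    union-root : ∀ β₁ β₂ → Root B₁ τ₁ β₁ → Root B₂ τ₂ β₂ → Root (B₁ ++ B₂) τ (union β₁ β₂)
    union-root β₁ β₂ ((β₁-inj , supp₁ , vals₁) , β₁ᵏ≡τ₁) ((β₂-inj , supp₂ , vals₂) , β₂ᵏ≡τ₂) =
      (injective , union-supported , values) , iter⇒^P≡ {β = union β₁ β₂} k power
      where
      open Glue disjoint β₁ β₂ supp₁ supp₂
      injective : IsInjective (union β₁ β₂)
      injective i j (y , e₁ , e₂) with union-defined e₁ | union-defined e₂
      ... | inj₁ (_ , a₁) | inj₁ (_ , a₂) = β₁-inj i j (y , a₁ , a₂)
      ... | inj₂ (_ , a₁) | inj₂ (_ , a₂) = β₂-inj i j (y , a₁ , a₂)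
      ... | inj₁ (_ , a₁) | inj₂ (_ , a₂) = ⊥-elim (disjoint (vals₁ i y a₁ , vals₂ j y a₂))
      ... | inj₂ (_ , a₁) | inj₁ (_ , a₂) = ⊥-elim (disjoint (vals₁ j y a₂ , vals₂ i y a₁))
      values : ∀ x y → lookup (union β₁ β₂) x ≡ just y → y ∈ B₁ ++ B₂
      values x y e with union-defined e
      ... | inj₁ (_ , a) = ∈-++⁺ˡ (vals₁ x y a)
      ... | inj₂ (_ , a) = ∈-++⁺ʳ B₁ (vals₂ x y a)
      power : ∀ z → iter (union β₁ β₂) k z ≡ lookup τ z
      power z with z ∈? B₁ | z ∈? B₂
      ... | yes z∈B₁ | _ =
        trans (iter-agree (union β₁ β₂) β₁ B₁ union-left (λ x y _ → vals₁ x y) k z z∈B₁)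
              (trans (^P≡⇒iter {β = β₁} k β₁ᵏ≡τ₁ z) (sym (τ-left z∈B₁)))
      ... | no _ | yes z∈B₂ =
        trans (iter-agree (union β₁ β₂) β₂ B₂ union-right (λ x y _ → vals₂ x y) k z z∈B₂)
              (trans (^P≡⇒iter {β = β₂} k β₂ᵏ≡τ₂ z) (sym (τ-right z∈B₂)))
      ... | no z∉B₁ | no z∉B₂ =
        trans (iter-outside (union β₁ β₂) union-supported k' z∉B) (sym (τ-supported z z∉B))
        where
        z∉B : ¬ z ∈ B₁ ++ B₂
        z∉B = ∉-++ z∉B₁ z∉B₂

    module _ (blocks-invariant : ∀ β → Root (B₁ ++ B₂) τ β → Preserves B₁ β × Preserves B₂ β) where

      split-root : ∀ β → Root (B₁ ++ B₂) τ β → Root B₁ τ₁ (restrict B₁ β) × Root B₂ τ₂ (restrict B₂ β)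
      split-root β root@((β-inj , _) , βᵏ≡τ) =
        restrict-root B₁ β β-inj βᵏ≡τ (proj₁ (blocks-invariant β root)) τ₁-supp τ-left ,
        restrict-root B₂ β β-inj βᵏ≡τ (proj₂ (blocks-invariant β root)) τ₂-supp τ-right

      split : PMap m → PMap m × PMap m
      split β = restrict B₁ β , restrict B₂ β

      glue : PMap m × PMap m → PMap m
      glue (β₁ , β₂) = union β₁ β₂

      split∈ : ∀ {β} → β ∈ roots (B₁ ++ B₂) τ → split β ∈ cartesianProduct (roots B₁ τ₁) (roots B₂ τ₂)
      split∈ {β} β∈ with split-root β (roots⇒root β∈)
      ... | root₁ , root₂ = ∈-cartesianProduct⁺ (root∈roots root₁) (root∈roots root₂)

      glue∈ : ∀ {βs} → βs ∈ cartesianProduct (roots B₁ τ₁) (roots B₂ τ₂) → glue βs ∈ roots (B₁ ++ B₂) τ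
      glue∈ {β₁ , β₂} βs∈ with ∈-cartesianProduct⁻ (roots B₁ τ₁) (roots B₂ τ₂) βs∈
      ... | β₁∈ , β₂∈ = root∈roots (union-root β₁ β₂ (roots⇒root β₁∈) (roots⇒root β₂∈))

      glue∘split : ∀ {β} → β ∈ roots (B₁ ++ B₂) τ → glue (split β) ≡ β
      glue∘split β∈ = union-restrict disjoint (proj₁ (proj₂ (proj₁ (roots⇒root β∈))))

      split∘glue : ∀ {βs} → βs ∈ cartesianProduct (roots B₁ τ₁) (roots B₂ τ₂) → split (glue βs) ≡ βs
      split∘glue {β₁ , β₂} βs∈ with ∈-cartesianProduct⁻ (roots B₁ τ₁) (roots B₂ τ₂) βs∈
      ... | β₁∈ , β₂∈ = cong₂ _,_ restrict-union₁ restrict-union₂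
        where open Glue disjoint β₁ β₂ (proj₁ (proj₂ (proj₁ (roots⇒root β₁∈)))) (proj₁ (proj₂ (proj₁ (roots⇒root β₂∈))))

      rOn-blocks : rOn (B₁ ++ B₂) k τ ≡ rOn B₁ k τ₁ * rOn B₂ k τ₂
      rOn-blocks = trans
        (bijection⇒length≡ (roots (B₁ ++ B₂) τ) (cartesianProduct (roots B₁ τ₁) (roots B₂ τ₂))
          (roots-unique (B₁ ++ B₂) τ) (cartesianProduct⁺ (roots-unique B₁ τ₁) (roots-unique B₂ τ₂))
          split glue split∈ glue∈ glue∘split split∘glue)
        (length-cartesianProductWith _,_ (roots B₁ τ₁) (roots B₂ τ₂))

-- §8  Separated path families: r_k factors, and the theorem follows by induction over the groups.

module _ {m : ℕ} where

  digits-++ : ∀ (g h : List (Path m)) → digits (g ++ h) ≡ digits g ++ digits h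
  digits-++ = concatMap-++ (λ p → p)

  pathsStep-++ : ∀ (g h : List (Path m)) x → pathsStep (g ++ h) x ≡ (pathsStep g x <∣> pathsStep h x)
  pathsStep-++ [] h x = refl
  pathsStep-++ (p ∷ g) h x with pathStep p x
  ... | just _ = refl
  ... | nothing = pathsStep-++ g h x

  prodPaths-++ : ∀ (g h : List (Path m)) → prodPaths (g ++ h) ≡ union (prodPaths g) (prodPaths h)
  prodPaths-++ g h = pmap-ext λ x → begin
    lookup (prodPaths (g ++ h)) x                                ≡⟨ lookup∘tabulate (pathsStep (g ++ h)) x ⟩
    pathsStep (g ++ h) x                                         ≡⟨ pathsStep-++ g h x ⟩
    (pathsStep g x <∣> pathsStep h x)                            ≡⟨ cong₂ _<∣>_ (sym (lookup∘tabulate (pathsStep g) x))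
                                                                                 (sym (lookup∘tabulate (pathsStep h) x)) ⟩
    (lookup (prodPaths g) x <∣> lookup (prodPaths h) x)          ≡⟨ sym (union-at (prodPaths g) (prodPaths h) x) ⟩
    lookup (union (prodPaths g) (prodPaths h)) x                 ∎
    where open ≡-Reasoning

  prodPaths-supported : ∀ (ps : List (Path m)) → SupportedOn (digits ps) (prodPaths ps)
  prodPaths-supported ps x x∉ with pathsStep ps x in psₓ | lookup∘tabulate (pathsStep ps) x
  ... | nothing | e = e
  ... | just y | _ = ⊥-elim (x∉ (occurs⇒digit (occurs-adjacent (pathsStep⇒adjacent ps psₓ))))
    where
    occurs-adjacent : ∀ {x y} → Adjacent ps x y → Occurs ps x
    occurs-adjacent (p , pre , post , p∈ps , p≡) = p , pre , _ , p∈ps , p≡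

  Separated : List (Path m) → List (Path m) → Set
  Separated g h = ∀ p q → p ∈ g → q ∈ h → 1 < ∣ ℓ p - ℓ q ∣

module SeparatedRoots {m : ℕ} (k' : ℕ) where
  open Roots {m} k'

  separated-invariant : ∀ (g h : List (Path m)) → Unique (digits (g ++ h)) → Separated g h →
    ∀ β → Root (digits g ++ digits h) (union (prodPaths g) (prodPaths h)) β →
    Preserves (digits g) β × Preserves (digits h) β
  separated-invariant g h u separated β ((β-inj , _ , values) , βᵏ≡τ) = preserves-g , preserves-h
    where
    open PathFamily (g ++ h) u using (root-step-length)
    βᵏ≡σ : β ^P k ≡ prodPaths (g ++ h)
    βᵏ≡σ = trans βᵏ≡τ (sym (prodPaths-++ g h))
    close : ∀ {x y} → lookup β x ≡ just y → ((p , _) : Occurs (g ++ h) x) ((q , _) : Occurs (g ++ h) y) →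
      ∣ ℓ p - ℓ q ∣ ≤ 1
    close βx≡y (p , pre , post , p∈ , p≡) (q , pre' , post' , q∈ , q≡) =
      root-step-length k' β βᵏ≡σ β-inj βx≡y pre post pre' post' p∈ q∈ p≡ q≡
    preserves-g : Preserves (digits g) β
    preserves-g x y x∈g βx≡y with ∈-++⁻ (digits g) (values x y βx≡y)
    ... | inj₁ y∈g = y∈g
    ... | inj₂ y∈h with digit⇒occurs g x∈g | digit⇒occurs h y∈h
    ...   | p , pre , post , p∈g , p≡ | q , pre' , post' , q∈h , q≡ = ⊥-elim (<⇒≱ (separated p q p∈g q∈h)
            (close βx≡y (p , pre , post , ∈-++⁺ˡ p∈g , p≡) (q , pre' , post' , ∈-++⁺ʳ g q∈h , q≡)))
    preserves-h : Preserves (digits h) β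
    preserves-h x y x∈h βx≡y with ∈-++⁻ (digits g) (values x y βx≡y)
    ... | inj₂ y∈h = y∈h
    ... | inj₁ y∈g with digit⇒occurs h x∈h | digit⇒occurs g y∈g
    ...   | p , pre , post , p∈h , p≡ | q , pre' , post' , q∈g , q≡ = ⊥-elim (<⇒≱ (separated q p q∈g p∈h)
            (subst (_≤ 1) (∣-∣-comm (ℓ p) (ℓ q))
              (close βx≡y (p , pre , post , ∈-++⁺ʳ g p∈h , p≡) (q , pre' , post' , ∈-++⁺ˡ q∈g , q≡))))

  rOn-separated : ∀ (g h : List (Path m)) → Unique (digits (g ++ h)) → Separated g h →
    rOn (digits (g ++ h)) k (prodPaths (g ++ h)) ≡ rOn (digits g) k (prodPaths g) * rOn (digits h) k (prodPaths h)
  rOn-separated g h u separated =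
    subst₂ (λ B τ → rOn B k τ ≡ rOn (digits g) k (prodPaths g) * rOn (digits h) k (prodPaths h))
      (sym (digits-++ g h)) (sym (prodPaths-++ g h))
      (Blocks.rOn-blocks disjoint (prodPaths-supported g) (prodPaths-supported h) (separated-invariant g h u separated))
    where
    disjoint : Disjoint (digits g) (digits h)
    disjoint = proj₂ (proj₂ (Unique-++⁻ (digits g) (digits h) (subst Unique (digits-++ g h) u)))

  rOn-[] : rOn [] k (prodPaths {m} []) ≡ 1
  rOn-[] = bijection⇒length≡ (roots [] ∅) (∅ ∷ []) (roots-unique [] ∅) (All.[] ∷ [])
    (λ _ → ∅) (λ _ → ∅) (λ β∈ → here refl) (λ { (here refl) → root∈roots ∅-root })
    (λ β∈ → pmap-ext λ x → trans (∅-nothing x) (sym (proj₁ (proj₂ (proj₁ (roots⇒root β∈))) x λ ())))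
    (λ { (here refl) → refl })
    where
    ∅ : PMap m
    ∅ = prodPaths []
    ∅-nothing : ∀ x → lookup ∅ x ≡ nothing
    ∅-nothing = lookup∘tabulate (pathsStep [])
    ∅-root : Root [] ∅ ∅
    ∅-root = ((λ i j (_ , ∅i≡y , _) → ⊥-elim (nothing≢just (trans (sym (∅-nothing i)) ∅i≡y)))
             , (λ x _ → ∅-nothing x)
             , (λ x y ∅x≡y → ⊥-elim (nothing≢just (trans (sym (∅-nothing x)) ∅x≡y))))
           , iter⇒^P≡ {β = ∅} k (λ z → trans (iter-outside {B = []} ∅ (λ x _ → ∅-nothing x) k' (λ ())) (sym (∅-nothing z)))

  rOn-concat : ∀ {n} (groups : Fin n → List (Path m)) (is : List (Fin n)) → Unique is →
    Unique (digits (concatMap groups is)) →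
    (∀ i j → i ≢ j → Separated (groups i) (groups j)) →
    rOn (digits (concatMap groups is)) k (prodPaths (concatMap groups is))
      ≡ product (map (λ i → rOn (digits (groups i)) k (prodPaths (groups i))) is)
  rOn-concat groups [] _ _ _ = rOn-[]
  rOn-concat groups (i ∷ is) (i∉is ∷ uis) u separated = begin
    rOn (digits (groups i ++ rest)) k (prodPaths (groups i ++ rest))
      ≡⟨ rOn-separated (groups i) rest u separated-from-rest ⟩
    rOn (digits (groups i)) k (prodPaths (groups i)) * rOn (digits rest) k (prodPaths rest)
      ≡⟨ cong (rOn (digits (groups i)) k (prodPaths (groups i)) *_) (rOn-concat groups is uis u-rest separated) ⟩
    product (map (λ j → rOn (digits (groups j)) k (prodPaths (groups j))) (i ∷ is)) ∎
    where
    open ≡-Reasoning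
    rest : List (Path m)
    rest = concatMap groups is
    u-rest : Unique (digits rest)
    u-rest = proj₁ (proj₂ (Unique-++⁻ (digits (groups i)) (digits rest) (subst Unique (digits-++ (groups i) rest) u)))
    separated-from-rest : Separated (groups i) rest
    separated-from-rest p q p∈ q∈ with ∈-concat⁻′ (map groups is) q∈
    ... | _ , q∈gj , gj∈ with ∈-map⁻ groups gj∈
    ...   | j , j∈is , refl = separated i j (λ i≡j → All.lookup i∉is j∈is i≡j) p q p∈ q∈gj

-- When the digits cover X, SIM(B) is all of SIM(X), so r_k and rOn agree.
r≡rOn : ∀ {m} k (B : List (Fin m)) (σ : PMap m) → (∀ x → x ∈ B) → r k σ ≡ rOn B k σ
r≡rOn {m} k B σ covers = cong length (filter-≐
  (λ α → isInjective? α ×-dec ≡-decV (≡-decM _≟F_) (α ^P k) σ)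
  (λ α → isSIMOn? B α ×-dec ≡-decV (≡-decM _≟F_) (α ^P k) σ)
  ((λ (α-inj , αᵏ≡σ) → (α-inj , (λ x x∉B → ⊥-elim (x∉B (covers x))) , (λ _ y _ → covers y)) , αᵏ≡σ)
  , (λ ((α-inj , _) , αᵏ≡σ) → α-inj , αᵏ≡σ))
  (allPMaps m))

theorem5 : (m k : ℕ) → 1 ≤ k →
    (n : ℕ) (groups : Fin n → List (Path m)) (σ : PMap m) →
    All (λ p → 1 ≤ ℓ p) (concatMap groups (allFin n)) →
    Unique (digits (concatMap groups (allFin n))) →
    (∀ (x : Fin m) → x ∈ digits (concatMap groups (allFin n))) →
    σ ≡ prodPaths (concatMap groups (allFin n)) →
    (∀ (i : Fin n) → WeaklyVarying (groups i)) →
    (∀ (i j : Fin n) → i ≢ j → ∀ (p q : Path m) → p ∈ groups i → q ∈ groups j →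
      1 < ∣ ℓ p - ℓ q ∣) →
    r k σ ≡ product (map (λ i → rOn (digits (groups i)) k (prodPaths (groups i))) (allFin n))
theorem5 m (suc k') (s≤s z≤n) n groups σ _ u covers refl _ separated =
  trans (r≡rOn (suc k') (digits (concatMap groups (allFin n))) σ covers)
        (SeparatedRoots.rOn-concat k' groups (allFin n) (allFin⁺ n) u separated)
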